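{- Let $R$ be a finite commutative local ring with identity which is not a field. Then $$\gamma^o(\Gamma(R)) \leq \left(|Z(R)^*| - \gamma^o(\Gamma(R))\right)\left( \gamma^o(\Gamma(R)) -1\right) + 1.$$
   Context: $Z(R)$ denotes the set of zero-divisors of $R$, including $0$, and $Z(R)^*=Z(R)\setminus\{0\}$. The zero-divisor graph $\Gamma(R)$ is the simple graph with vertex set $Z(R)^*$, in which distinct $u,v$ are adjacent if and only if $uv=0$. For a simple graph $\Gamma=(V,E)$, a set $S\subseteq V$ and a vertex $v$, let $\delta_S(v)$ be the number of neighbors of $v$ in $S$ and $\overline{S}=V\setminus S$. A nonempty set $S\subseteq V$ is a global offensive alliance if $\delta_S(v)\geq \delta_{\overline{S}}(v)+1$ for every $v\in\overline{S}$. $\gamma^o(\Gamma)$ is the minimum cardinality of a global offensive alliance of $\Gamma$. -}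

module Defs where

open import Level using (0ℓ)
open import Data.Nat using (ℕ; suc; _≤_)
open import Data.Fin using (Fin)
open import Data.Fin.Properties using (any?) renaming (_≟_ to _≟ᶠ_)
open import Data.Fin.Subset using (Subset; _∈_; _∉_; _⊆_; _∩_; ∁; ∣_∣; Nonempty)
open import Data.Fin.Subset.Properties using (_∈?_)
open import Data.Vec using (tabulate)
open import Data.Product using (Σ; ∃; _×_; _,_)
open import Relation.Nullary using (¬_; ¬?; Dec; yes; no; _×-dec_)

open import Relation.Nullary.Decidable using (⌊_⌋)
open import Relation.Binary.PropositionalEquality using (_≡_; _≢_)
open import Algebra.Core using (Op₁; Op₂)
open import Algebra.Structures using (IsCommutativeRing)

-- Every finite ring is isomorphic to
-- one whose carrier is Fin n (n = |R|), and all notions below are invariant under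
-- ring isomorphism, so we take the carrier to be Fin n with propositional equality.
record FinCommRing : Set where
  field
    n    : ℕ
    _+_  : Op₂ (Fin n)
    _*_  : Op₂ (Fin n)
    -_   : Op₁ (Fin n)
    0#   : Fin n
    1#   : Fin n
    isCommutativeRing : IsCommutativeRing _≡_ _+_ _*_ -_ 0# 1#

module _ (R : FinCommRing) where
  open FinCommRing R

  IsIdeal : Subset n → Set
  IsIdeal I = (0# ∈ I)
            × (∀ x y → x ∈ I → y ∈ I → (x + y) ∈ I)
            × (∀ x → x ∈ I → (- x) ∈ I)
            × (∀ r x → x ∈ I → (r * x) ∈ I)

  IsProperIdeal : Subset n → Set
  IsProperIdeal I = IsIdeal I × (1# ∉ I)

  IsMaximalIdeal : Subset n → Set
  IsMaximalIdeal M = IsProperIdeal M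
                   × (∀ J → IsProperIdeal J → M ⊆ J → J ≡ M)

  IsLocal : Set
  IsLocal = Σ (Subset n) λ M → IsMaximalIdeal M × (∀ M' → IsMaximalIdeal M' → M' ≡ M)

  IsField : Set
  IsField = (1# ≢ 0#) × (∀ x → x ≢ 0# → ∃ λ y → (x * y) ≡ 1#)

  -- x ∈ Z(R): x is a zero-divisor (0 included)
  IsZeroDivisor : Fin n → Set
  IsZeroDivisor x = ∃ λ y → (y ≢ 0#) × ((x * y) ≡ 0#)

  IsNonzeroZD : Fin n → Set
  IsNonzeroZD x = (x ≢ 0#) × IsZeroDivisor x

  isNonzeroZD? : ∀ x → Dec (IsNonzeroZD x)
  isNonzeroZD? x = ¬? (x ≟ᶠ 0#) ×-dec any? (λ y → ¬? (y ≟ᶠ 0#) ×-dec ((x * y) ≟ᶠ 0#))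

  Zstar : Subset n
  Zstar = tabulate (λ x → ⌊ isNonzeroZD? x ⌋)

  -- adjacency in Γ(R) (only used between vertices)
  Adj : Fin n → Fin n → Set
  Adj u v = (u ≢ v) × ((u * v) ≡ 0#)

  adj? : ∀ u v → Dec (Adj u v)
  adj? u v = ¬? (u ≟ᶠ v) ×-dec ((u * v) ≟ᶠ 0#)

  δ : Subset n → Fin n → ℕ
  δ S v = ∣ tabulate (λ u → ⌊ (u ∈? S) ×-dec adj? u v ⌋) ∣

  compl : Subset n → Subset n
  compl S = Zstar ∩ ∁ S

  -- global offensive alliance of Γ(R)
  IsGOA : Subset n → Set
  IsGOA S = (S ⊆ Zstar) × Nonempty S
          × (∀ v → v ∈ Zstar → v ∉ S → suc (δ (compl S) v) ≤ δ S v)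

  IsGammaO : ℕ → Set
  IsGammaO k = (Σ (Subset n) λ S → IsGOA S × ∣ S ∣ ≡ k)
             × (∀ S → IsGOA S → k ≤ ∣ S ∣)

-- If γᵒ ≥ 2, a minimum alliance contains two distinct vertices, and in a zero-divisor
-- graph that already forces an edge u — v.  Deleting v from Z(R)* then leaves a global
-- offensive alliance: v is the only vertex outside, it has the neighbour u inside and no
-- neighbour outside.  Hence γᵒ < |Z(R)*|, and the bound follows from |Z(R)*| − γᵒ ≥ 1.
module Submission where

open import Defs
open import Data.Nat using (ℕ; zero; suc; _≤_; _<_; _*_; _+_; _∸_; z≤n; s≤s; _≤?_)
open import Data.Nat.Properties
  using (≤-trans; ≤-<-trans; m≤n+m; +-comm; *-identityˡ; *-monoˡ-≤; +-monoˡ-≤; m<n⇒0<n∸m; ≰⇒>; module ≤-Reasoning)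
open import Level using (0ℓ)
open import Data.Bool.Properties using (T-≡)
open import Data.Fin using (Fin)
open import Data.Fin.Properties using (any?) renaming (_≟_ to _≟ᶠ_)
open import Data.Fin.Subset using (Subset; _∈_; _∉_; _⊆_; ∁; ∣_∣; Empty; _-_; ⁅_⁆)
open import Data.Fin.Subset.Properties
  using (_∈?_; Empty-unique; ∣⊥∣≡0; ∣⁅x⁆∣≡1; x∈⁅x⁆; x∈⁅y⁆⇒x≡y; p⊆q⇒∣p∣≤∣q∣; x∈p∩q⁻; x∈∁p⇒x∉p;
         p─q⊆p; x∈p∧x≢y⇒x∈p-y; x∈p⇒∣p-x∣<∣p∣)
open import Data.Vec using (tabulate)
open import Data.Vec.Properties using (lookup∘tabulate; []=⇒lookup; lookup⇒[]=)
open import Data.Product using (∃; _×_; _,_; proj₁)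
open import Function.Bundles using (Equivalence)
open import Relation.Nullary using (¬_; ¬?; yes; no; _×-dec_; contradiction)
open import Relation.Nullary.Decidable using (⌊_⌋; toWitness; fromWitness)
open import Relation.Unary using (Pred; Decidable)
open import Relation.Binary.PropositionalEquality using (_≡_; _≢_; refl; sym; trans; cong; subst; module ≡-Reasoning)
open import Algebra.Structures using (IsCommutativeRing)

module _ {n} {P : Pred (Fin n) 0ℓ} (P? : Decidable P) where

  ∈-tabulate⁻ : ∀ {x} → x ∈ tabulate (λ y → ⌊ P? y ⌋) → P x
  ∈-tabulate⁻ {x} x∈ = toWitness (Equivalence.from T-≡
    (trans (sym (lookup∘tabulate (λ y → ⌊ P? y ⌋) x)) ([]=⇒lookup x∈)))

  ∈-tabulate⁺ : ∀ {x} → P x → x ∈ tabulate (λ y → ⌊ P? y ⌋)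
  ∈-tabulate⁺ {x} px = lookup⇒[]= x _
    (trans (lookup∘tabulate (λ y → ⌊ P? y ⌋) x) (Equivalence.to T-≡ (fromWitness px)))

module _ {n} {p : Subset n} where

  x∈p⇒1≤∣p∣ : ∀ {x} → x ∈ p → 1 ≤ ∣ p ∣
  x∈p⇒1≤∣p∣ {x} x∈p = subst (_≤ ∣ p ∣) (∣⁅x⁆∣≡1 x)
    (p⊆q⇒∣p∣≤∣q∣ λ y∈⁅x⁆ → subst (_∈ p) (sym (x∈⁅y⁆⇒x≡y x y∈⁅x⁆)) x∈p)

  Empty⇒∣p∣≡0 : Empty p → ∣ p ∣ ≡ 0
  Empty⇒∣p∣≡0 empty = trans (cong ∣_∣ (Empty-unique empty)) (∣⊥∣≡0 n)

  ⊆⁅x⁆⇒∣p∣≤1 : ∀ {x} → p ⊆ ⁅ x ⁆ → ∣ p ∣ ≤ 1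
  ⊆⁅x⁆⇒∣p∣≤1 {x} p⊆⁅x⁆ = subst (∣ p ∣ ≤_) (∣⁅x⁆∣≡1 x) (p⊆q⇒∣p∣≤∣q∣ p⊆⁅x⁆)

  2≤∣p∣⇒∃-other : ∀ {x} → 2 ≤ ∣ p ∣ → ∃ λ y → y ∈ p × y ≢ x
  2≤∣p∣⇒∃-other {x} 2≤∣p∣ with any? (λ y → (y ∈? p) ×-dec ¬? (y ≟ᶠ x))
  ... | yes other = other
  ... | no no-other = contradiction (≤-trans 2≤∣p∣ (⊆⁅x⁆⇒∣p∣≤1 p⊆⁅x⁆)) λ { (s≤s ()) }
    where
    p⊆⁅x⁆ : p ⊆ ⁅ x ⁆
    p⊆⁅x⁆ {y} y∈p with y ≟ᶠ x
    ... | yes refl = x∈⁅x⁆ x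
    ... | no y≢x = contradiction (y , y∈p , y≢x) no-other

k<m⇒k≤[m∸k]*[k∸1]+1 : ∀ {k m} → k < m → k ≤ (m ∸ k) * (k ∸ 1) + 1
k<m⇒k≤[m∸k]*[k∸1]+1 {zero} _ = z≤n
k<m⇒k≤[m∸k]*[k∸1]+1 {suc j} {m} k<m = begin
  suc j                  ≡⟨ +-comm 1 j ⟩
  j + 1                  ≡⟨ cong (_+ 1) (sym (*-identityˡ j)) ⟩
  1 * j + 1              ≤⟨ +-monoˡ-≤ 1 (*-monoˡ-≤ j (m<n⇒0<n∸m k<m)) ⟩
  (m ∸ suc j) * j + 1    ∎
  where open ≤-Reasoning

module _ (R : FinCommRing) where
  open FinCommRing R using (n; 0#) renaming (_*_ to _·_)
  open IsCommutativeRing (FinCommRing.isCommutativeRing R) using (*-comm; *-assoc; zeroˡ; zeroʳ)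

  ∈Z*⁻ : ∀ {x} → x ∈ Zstar R → IsNonzeroZD R x
  ∈Z*⁻ = ∈-tabulate⁻ (isNonzeroZD? R)

  ∈Z*⁺ : ∀ {x} → IsNonzeroZD R x → x ∈ Zstar R
  ∈Z*⁺ = ∈-tabulate⁺ (isNonzeroZD? R)

  record Edge : Set where
    constructor edge
    field
      {u v} : Fin n
      u∈Z* : u ∈ Zstar R
      v∈Z* : v ∈ Zstar R
      u~v  : Adj R u v

  annihilator⇒edge : ∀ {x a} → x ∈ Zstar R → a ≢ 0# → a ≢ x → x · a ≡ 0# → Edge
  annihilator⇒edge {x} {a} x∈Z* a≢0 a≢x xa≡0 =
    edge (∈Z*⁺ (a≢0 , x , proj₁ (∈Z*⁻ x∈Z*) , ax≡0)) x∈Z* (a≢x , ax≡0)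
    where
    ax≡0 : a · x ≡ 0#
    ax≡0 = trans (*-comm a x) xa≡0

  two-vertices⇒edge : ∀ {x z} → x ∈ Zstar R → z ∈ Zstar R → z ≢ x → Edge
  two-vertices⇒edge {x} {z} x∈Z* z∈Z* z≢x with ∈Z*⁻ x∈Z* | ∈Z*⁻ z∈Z*
  ... | _ , y , y≢0 , xy≡0 | _ , w , w≢0 , zw≡0 with y ≟ᶠ x
  ... | no y≢x = annihilator⇒edge x∈Z* y≢0 y≢x xy≡0
  ... | yes refl with (x · z) ≟ᶠ 0#
  ...   | yes xz≡0 = annihilator⇒edge x∈Z* (λ { refl → proj₁ (∈Z*⁻ z∈Z*) refl }) z≢x xz≡0
  -- Now x² = 0, so x kills x z; and if x z = x it also kills every annihilator of z.
  ...   | no xz≢0 with (x · z) ≟ᶠ x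
  ...     | no xz≢x = annihilator⇒edge x∈Z* xz≢0 xz≢x x·xz≡0
    where
    x·xz≡0 : x · (x · z) ≡ 0#
    x·xz≡0 = begin
      x · (x · z)  ≡⟨ *-assoc x x z ⟨
      (x · x) · z  ≡⟨ cong (_· z) xy≡0 ⟩
      0# · z       ≡⟨ zeroˡ z ⟩
      0#           ∎
      where open ≡-Reasoning
  ...     | yes xz≡x with w ≟ᶠ x
  ...       | yes refl = contradiction (trans (*-comm x z) zw≡0) xz≢0
  ...       | no w≢x = annihilator⇒edge x∈Z* w≢0 w≢x xw≡0
    where
    xw≡0 : x · w ≡ 0#
    xw≡0 = begin
      x · w        ≡⟨ cong (_· w) xz≡x ⟨
      (x · z) · w  ≡⟨ *-assoc x z w ⟩
      x · (z · w)  ≡⟨ cong (x ·_) zw≡0 ⟩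
      x · 0#       ≡⟨ zeroʳ x ⟩
      0#           ∎
      where open ≡-Reasoning

  neighbour⇒1≤δ : ∀ {S u v} → u ∈ S → Adj R u v → 1 ≤ δ R S v
  neighbour⇒1≤δ {S} {u} {v} u∈S u~v =
    x∈p⇒1≤∣p∣ (∈-tabulate⁺ (λ y → (y ∈? S) ×-dec adj? R y v) (u∈S , u~v))

  no-neighbour⇒δ≡0 : ∀ {S v} → (∀ {u} → u ∈ S → ¬ Adj R u v) → δ R S v ≡ 0
  no-neighbour⇒δ≡0 {S} {v} no-neighbour = Empty⇒∣p∣≡0 λ (u , u∈) →
    let u∈S , u~v = ∈-tabulate⁻ (λ y → (y ∈? S) ×-dec adj? R y v) u∈ in no-neighbour u∈S u~v

  Z*-v-isGOA : (e : Edge) → IsGOA R (Zstar R - Edge.v e)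
  Z*-v-isGOA (edge {u} {v} u∈Z* _ u~v) = p─q⊆p (Zstar R) ⁅ v ⁆ , (u , u∈T) , offensive
    where
    T : Subset n
    T = Zstar R - v

    u∈T : u ∈ T
    u∈T = x∈p∧x≢y⇒x∈p-y u∈Z* (proj₁ u~v)

    outside⇒≡v : ∀ {w} → w ∈ Zstar R → w ∉ T → w ≡ v
    outside⇒≡v {w} w∈Z* w∉T with w ≟ᶠ v
    ... | yes w≡v = w≡v
    ... | no w≢v = contradiction (x∈p∧x≢y⇒x∈p-y w∈Z* w≢v) w∉T

    v-isolated-outside : ∀ {w} → w ∈ compl R T → ¬ Adj R w v
    v-isolated-outside w∈compl (w≢v , _) with x∈p∩q⁻ (Zstar R) (∁ T) w∈compl
    ... | w∈Z* , w∈∁T = w≢v (outside⇒≡v w∈Z* (x∈∁p⇒x∉p w∈∁T))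

    offensive : ∀ w → w ∈ Zstar R → w ∉ T → suc (δ R (compl R T) w) ≤ δ R T w
    offensive w w∈Z* w∉T with outside⇒≡v w∈Z* w∉T
    ... | refl = subst (λ d → suc d ≤ δ R T v) (sym (no-neighbour⇒δ≡0 v-isolated-outside))
                   (neighbour⇒1≤δ u∈T u~v)

  γᵒ<∣Z*∣ : ∀ {k} → IsGammaO R k → 2 ≤ k → k < ∣ Zstar R ∣
  γᵒ<∣Z*∣ ((S , (S⊆Z* , (x , x∈S) , _) , ∣S∣≡k) , minimal) 2≤k =
    let z , z∈S , z≢x = 2≤∣p∣⇒∃-other (subst (2 ≤_) (sym ∣S∣≡k) 2≤k)
        e = two-vertices⇒edge (S⊆Z* x∈S) (S⊆Z* z∈S) z≢x
    in ≤-<-trans (minimal _ (Z*-v-isGOA e)) (x∈p⇒∣p-x∣<∣p∣ (Edge.v∈Z* e))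

theorem2p2 : (R : FinCommRing) → IsLocal R → ¬ IsField R →
    (k : ℕ) → IsGammaO R k →
    k ≤ (∣ Zstar R ∣ ∸ k) * (k ∸ 1) + 1
theorem2p2 R _ _ k γᵒ≡k with k ≤? 1
... | yes k≤1 = ≤-trans k≤1 (m≤n+m 1 _)
... | no k≰1 = k<m⇒k≤[m∸k]*[k∸1]+1 (γᵒ<∣Z*∣ R γᵒ≡k (≰⇒> k≰1))
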